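{- Let $G$ be a cubic graph and let $M_1,M_2,M_3,M_4$ be perfect matchings of $G$ such that every edge of $G$ lies in at least one of them. Then: (1) every edge of $G$ is contained in exactly one or exactly two of $M_1,\ldots,M_4$; (2) the set of edges contained in exactly two of $M_1,\ldots,M_4$ is a perfect matching of $G$; (3) if $\tau(G)=4$, then $M_i\cap M_j\neq\emptyset$ for all $i\neq j$ in $\{1,2,3,4\}$.
   Context: For a bridgeless cubic graph $G$, the perfect matching index $\tau(G)$ is the minimum number of perfect matchings of $G$ whose union is $E(G)$. -}

module Defs where

open import Data.Nat using (ℕ; zero; suc; _+_; _<_)
open import Data.Bool using (Bool; true; false; if_then_else_)
open import Data.Fin using (Fin; zero; suc; _≟_)
open import Data.Fin.Subset using (Subset; _∈_)
open import Data.Vec using (tabulate; lookup)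
open import Data.Product using (Σ; ∃; _×_; _,_; proj₁; proj₂)
open import Data.Sum using (_⊎_)
open import Relation.Binary.PropositionalEquality using (_≡_; _≢_)
open import Relation.Nullary using (¬_; does)
open import Data.Nat using () renaming (_≟_ to _≟ℕ_)

countTrue : (k : ℕ) → (Fin k → Bool) → ℕ
countTrue zero    f = 0
countTrue (suc k) f = (if f zero then 1 else 0) + countTrue k (λ i → f (suc i))

-- A finite loopless multigraph: vertices Fin n, edges Fin m, each edge
-- has two distinct ends (parallel edges allowed).
record Graph : Set where
  field
    n        : ℕ
    m        : ℕ
    end₁     : Fin m → Fin n
    end₂     : Fin m → Fin n
    loopless : ∀ e → end₁ e ≢ end₂ e

open Graph public

Vertex : Graph → Set
Vertex G = Fin (n G)

Edge : Graph → Set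
Edge G = Fin (m G)

EdgeSet : Graph → Set
EdgeSet G = Subset (m G)

Incident : (G : Graph) → Edge G → Vertex G → Set
Incident G e v = (end₁ G e ≡ v) ⊎ (end₂ G e ≡ v)

incident? : (G : Graph) → Edge G → Vertex G → Bool
incident? G e v = if does (end₁ G e ≟ v) then true else does (end₂ G e ≟ v)

degree : (G : Graph) → Vertex G → ℕ
degree G v = countTrue (m G) (λ e → incident? G e v)

Cubic : Graph → Set
Cubic G = ∀ v → degree G v ≡ 3

PerfectMatching : (G : Graph) → EdgeSet G → Set
PerfectMatching G M =
  ∀ v → Σ (Edge G) λ e → (e ∈ M) × Incident G e v ×
        (∀ e′ → e′ ∈ M → Incident G e′ v → e′ ≡ e)

IsPMCover : (G : Graph) (k : ℕ) → (Fin k → EdgeSet G) → Set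
IsPMCover G k Ms = (∀ i → PerfectMatching G (Ms i)) × (∀ e → ∃ λ i → e ∈ Ms i)

HasPMCover : Graph → ℕ → Set
HasPMCover G k = ∃ λ (Ms : Fin k → EdgeSet G) → IsPMCover G k Ms

PMIndexIs : Graph → ℕ → Set
PMIndexIs G t = HasPMCover G t × (∀ k → k < t → ¬ HasPMCover G k)

multiplicity : (G : Graph) {k : ℕ} → (Fin k → EdgeSet G) → Edge G → ℕ
multiplicity G {k} Ms e = countTrue k (λ i → lookup (Ms i) e)

exactlyTwo : (G : Graph) {k : ℕ} → (Fin k → EdgeSet G) → EdgeSet G
exactlyTwo G Ms = tabulate (λ e → does (multiplicity G Ms e ≟ℕ 2))

module Submission where

-- In a cubic graph every vertex v is incident with exactly three
-- distinct edges a, b, c (its "star"), and an edge set is a perfect matching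
-- iff at every star exactly one of a, b, c belongs to it.  Hence, if k perfect
-- matchings are given, the multiplicities of a, b, c add up to k.  For a cover
-- by four perfect matchings all multiplicities are at least 1, so at each star
-- they are 2, 1, 1 in some order.  This gives (1) at once, and (2) because the
-- edges of multiplicity 2 then meet every star exactly once.  For (3): if two
-- of the matchings were disjoint, then at every star they would occupy two
-- different edges, so the remaining edges form a third perfect matching and
-- the three would cover E(G), contradicting τ(G) = 4.

open import Defs
open import Data.Nat using (ℕ; zero; suc; _+_; _≤_; s≤s; z≤n)
open import Data.Nat.Properties using (≤-refl; ≤-trans; m≤n+m; suc-injective; +-suc)
open import Data.Bool using (Bool; true; false; if_then_else_; not; _∨_)
open import Data.Fin using (Fin; zero; suc; _≟_)
open import Data.Fin.Subset using (Subset; _∈_)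
open import Data.Fin.Properties using (any?)
open import Data.Fin.Subset.Properties using (_∈?_)
open import Data.Vec using (lookup; tabulate)
open import Data.Vec.Properties using ([]=⇒lookup; lookup⇒[]=; lookup∘tabulate)
open import Data.Product using (Σ; ∃; _×_; _,_; proj₁; proj₂)
open import Data.Sum using (_⊎_; inj₁; inj₂)
open import Data.Empty using (⊥; ⊥-elim)
open import Relation.Nullary using (¬_; yes; no; does)
open import Relation.Nullary.Decidable using (_×-dec_)
open import Relation.Binary.PropositionalEquality using (_≡_; _≢_; refl; sym; trans; cong; cong₂; module ≡-Reasoning)
open import Data.Nat using () renaming (_≟_ to _≟ℕ_)

-- f with the entry at a switched off; used to extract the edges of a star one by one.
without : ∀ {k} → Fin k → (Fin k → Bool) → Fin k → Bool
without a f x = if does (x ≟ a) then false else f x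

without-true : ∀ {k} (a : Fin k) f x → without a f x ≡ true → f x ≡ true × x ≢ a
without-true a f x p with x ≟ a | p
... | yes _  | ()
... | no x≢a | fx = fx , x≢a

without-other : ∀ {k} (a : Fin k) f x → x ≢ a → without a f x ≡ f x
without-other a f x x≢a with x ≟ a
... | yes x≡a = ⊥-elim (x≢a x≡a)
... | no _    = refl

countTrue-pick : ∀ k f n → countTrue k f ≡ suc n →
  Σ (Fin k) λ a → (f a ≡ true) × (countTrue k (without a f) ≡ n)
countTrue-pick (suc k) f n eq with f zero in f0
... | true  = zero , f0 , suc-injective eq
... | false with countTrue-pick k (λ i → f (suc i)) n eq
...   | a , fa , count = suc a , fa , count

countTrue-zero : ∀ k f → countTrue k f ≡ 0 → ∀ x → f x ≡ false
countTrue-zero (suc k) f eq x with f zero in f0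
countTrue-zero (suc k) f () x       | true
countTrue-zero (suc k) f eq zero    | false = f0
countTrue-zero (suc k) f eq (suc x) | false = countTrue-zero k (λ i → f (suc i)) eq x

countTrue-pos : ∀ k f i → f i ≡ true → 1 ≤ countTrue k f
countTrue-pos (suc k) f zero    fi rewrite fi = s≤s z≤n
countTrue-pos (suc k) f (suc i) fi =
  ≤-trans (countTrue-pos k (λ j → f (suc j)) i fi) (m≤n+m _ (if f zero then 1 else 0))

-- Exactly one of three booleans is true: the trace of a perfect matching on a star.
data One : Bool → Bool → Bool → Set where
  first  : One true false false
  second : One false true false
  third  : One false false true

one-subst : ∀ {x y z x′ y′ z′} → x ≡ x′ → y ≡ y′ → z ≡ z′ → One x y z → One x′ y′ z′
one-subst refl refl refl o = o

countTrue-one : ∀ k (f g h : Fin k → Bool) → (∀ i → One (f i) (g i) (h i)) →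
  countTrue k f + countTrue k g + countTrue k h ≡ k
countTrue-one zero    f g h one = refl
countTrue-one (suc k) f g h one =
  step (one zero) _ _ _ (countTrue-one k (λ i → f (suc i)) (λ i → g (suc i)) (λ i → h (suc i)) (λ i → one (suc i)))
  where
    bit : Bool → ℕ
    bit b = if b then 1 else 0
    step : ∀ {x y z} → One x y z → ∀ p q r → p + q + r ≡ k →
      (bit x + p) + (bit y + q) + (bit z + r) ≡ suc k
    step first  p q r eq = cong suc eq
    step second p q r eq rewrite +-suc p q = cong suc eq
    step third  p q r eq rewrite +-suc (p + q) r = cong suc eq

one-complement : ∀ {x y z x′ y′ z′} → One x y z → One x′ y′ z′ →
  (x ≡ true → x′ ≡ true → ⊥) → (y ≡ true → y′ ≡ true → ⊥) → (z ≡ true → z′ ≡ true → ⊥) →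
  One (not (x ∨ x′)) (not (y ∨ y′)) (not (z ∨ z′))
one-complement first  first  h _ _ = ⊥-elim (h refl refl)
one-complement first  second _ _ _ = third
one-complement first  third  _ _ _ = second
one-complement second first  _ _ _ = third
one-complement second second _ h _ = ⊥-elim (h refl refl)
one-complement second third  _ _ _ = first
one-complement third  first  _ _ _ = second
one-complement third  second _ _ _ = first
one-complement third  third  _ _ h = ⊥-elim (h refl refl)

incident?⇒Incident : (G : Graph) → ∀ e v → incident? G e v ≡ true → Incident G e v
incident?⇒Incident G e v p with end₁ G e ≟ v
... | yes q = inj₁ q
... | no _ with end₂ G e ≟ v
...   | yes q = inj₂ q
incident?⇒Incident G e v () | no _ | no _

Incident⇒incident? : (G : Graph) → ∀ e v → Incident G e v → incident? G e v ≡ true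
Incident⇒incident? G e v inc with end₁ G e ≟ v | inc
... | yes _ | _ = refl
... | no ¬p | inj₁ p = ⊥-elim (¬p p)
... | no _  | inj₂ q with end₂ G e ≟ v
...   | yes _ = refl
...   | no ¬q = ⊥-elim (¬q q)

incidentAt : (G : Graph) → Vertex G → Edge G → Bool
incidentAt G v e = incident? G e v

record Star (G : Graph) (v : Vertex G) : Set where
  field
    a b c    : Edge G
    a-inc    : Incident G a v
    b-inc    : Incident G b v
    c-inc    : Incident G c v
    a≢b      : a ≢ b
    a≢c      : a ≢ c
    b≢c      : b ≢ c
    complete : ∀ e → Incident G e v → (e ≡ a) ⊎ (e ≡ b) ⊎ (e ≡ c)

-- Degree 3 yields a star: pick three incident edges one after another; the
-- remaining count is 0, so no further edge is incident with v.
star : (G : Graph) → Cubic G → ∀ v → Star G v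
star G cubic v with countTrue-pick (m G) (incidentAt G v) 2 (cubic v)
... | a , a-in , count₂ with countTrue-pick (m G) (without a (incidentAt G v)) 1 count₂
... | b , b-in , count₁ with countTrue-pick (m G) (without b (without a (incidentAt G v))) 0 count₁
... | c , c-in , count₀ = record
  { a = a ; b = b ; c = c
  ; a-inc = incident?⇒Incident G a v a-in
  ; b-inc = incident?⇒Incident G b v (proj₁ b-in′)
  ; c-inc = incident?⇒Incident G c v (proj₁ (without-true a inc c (proj₁ c-in′)))
  ; a≢b = λ eq → proj₂ b-in′ (sym eq)
  ; a≢c = λ eq → proj₂ (without-true a inc c (proj₁ c-in′)) (sym eq)
  ; b≢c = λ eq → proj₂ c-in′ (sym eq)
  ; complete = complete }
  where
    inc : Edge G → Bool
    inc = incidentAt G v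
    b-in′ : inc b ≡ true × b ≢ a
    b-in′ = without-true a inc b b-in
    c-in′ : without a inc c ≡ true × c ≢ b
    c-in′ = without-true b (without a inc) c c-in
    rest : Edge G → Bool
    rest = without c (without b (without a inc))
    survives : ∀ e → Incident G e v → e ≢ a → e ≢ b → e ≢ c → rest e ≡ true
    survives e e-inc e≢a e≢b e≢c = begin
      rest e                      ≡⟨ without-other c (without b (without a inc)) e e≢c ⟩
      without b (without a inc) e ≡⟨ without-other b (without a inc) e e≢b ⟩
      without a inc e             ≡⟨ without-other a inc e e≢a ⟩
      inc e                       ≡⟨ Incident⇒incident? G e v e-inc ⟩
      true                        ∎
      where open ≡-Reasoning
    complete : ∀ e → Incident G e v → (e ≡ a) ⊎ (e ≡ b) ⊎ (e ≡ c)
    complete e e-inc with e ≟ a | e ≟ b | e ≟ c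
    ... | yes p | _     | _     = inj₁ p
    ... | no _  | yes p | _     = inj₂ (inj₁ p)
    ... | no _  | no _  | yes p = inj₂ (inj₂ p)
    ... | no e≢a | no e≢b | no e≢c
          with trans (sym (countTrue-zero (m G) rest count₀ e)) (survives e e-inc e≢a e≢b e≢c)
    ...   | ()

MatchedAt : (G : Graph) → EdgeSet G → Vertex G → Set
MatchedAt G M v = Σ (Edge G) λ e → (e ∈ M) × Incident G e v × (∀ e′ → e′ ∈ M → Incident G e′ v → e′ ≡ e)

OneAt : {G : Graph} {v : Vertex G} → Star G v → (Edge G → Bool) → Set
OneAt st χ = One (χ (Star.a st)) (χ (Star.b st)) (χ (Star.c st))

false-of-∉ : ∀ {k} {M : Subset k} {x} → ¬ (x ∈ M) → false ≡ lookup M x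
false-of-∉ {M = M} {x} x∉M with lookup M x in eq
... | true  = ⊥-elim (x∉M (lookup⇒[]= x M eq))
... | false = refl

-- A perfect matching picks exactly one edge of every star, since the edge
-- matched at v is one of a, b, c and is the only one in M.
matched⇒one : (G : Graph) {v : Vertex G} (st : Star G v) (M : EdgeSet G) →
  MatchedAt G M v → OneAt st (lookup M)
matched⇒one G st M (e , e∈M , e-inc , unique) with Star.complete st e e-inc
... | inj₁ refl =
  one-subst (sym ([]=⇒lookup e∈M)) (false-of-∉ λ b∈M → Star.a≢b st (sym (unique _ b∈M (Star.b-inc st))))
            (false-of-∉ λ c∈M → Star.a≢c st (sym (unique _ c∈M (Star.c-inc st)))) first
... | inj₂ (inj₁ refl) =
  one-subst (false-of-∉ λ a∈M → Star.a≢b st (unique _ a∈M (Star.a-inc st))) (sym ([]=⇒lookup e∈M))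
            (false-of-∉ λ c∈M → Star.b≢c st (sym (unique _ c∈M (Star.c-inc st)))) second
... | inj₂ (inj₂ refl) =
  one-subst (false-of-∉ λ a∈M → Star.a≢c st (unique _ a∈M (Star.a-inc st)))
            (false-of-∉ λ b∈M → Star.b≢c st (unique _ b∈M (Star.b-inc st))) (sym ([]=⇒lookup e∈M)) third

one⇒matched : (G : Graph) {v : Vertex G} (st : Star G v) (M : EdgeSet G) →
  OneAt st (lookup M) → MatchedAt G M v
one⇒matched G {v} st M one = pick one refl refl refl
  where
    open Star st
    in-M : ∀ {e} → lookup M e ≡ true → e ∈ M
    in-M {e} = lookup⇒[]= e M
    excluded : ∀ {e} → lookup M e ≡ false → ¬ (e ∈ M)
    excluded Me≡false e∈M with trans (sym ([]=⇒lookup e∈M)) Me≡false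
    ... | ()
    only : ∀ e → e ∈ M → (a ∈ M → e ≡ a) → (b ∈ M → e ≡ b) → (c ∈ M → e ≡ c) →
      ∀ e′ → e′ ∈ M → Incident G e′ v → e′ ≡ e
    only e _ ha hb hc e′ e′∈M e′-inc with complete e′ e′-inc
    ... | inj₁ refl        = sym (ha e′∈M)
    ... | inj₂ (inj₁ refl) = sym (hb e′∈M)
    ... | inj₂ (inj₂ refl) = sym (hc e′∈M)
    pick : ∀ {x y z} → One x y z → lookup M a ≡ x → lookup M b ≡ y → lookup M c ≡ z → MatchedAt G M v
    pick first  pa pb pc = a , in-M pa , a-inc ,
      only a (in-M pa) (λ _ → refl) (λ b∈M → ⊥-elim (excluded pb b∈M)) (λ c∈M → ⊥-elim (excluded pc c∈M))
    pick second pa pb pc = b , in-M pb , b-inc ,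
      only b (in-M pb) (λ a∈M → ⊥-elim (excluded pa a∈M)) (λ _ → refl) (λ c∈M → ⊥-elim (excluded pc c∈M))
    pick third  pa pb pc = c , in-M pc , c-inc ,
      only c (in-M pc) (λ a∈M → ⊥-elim (excluded pa a∈M)) (λ b∈M → ⊥-elim (excluded pb b∈M)) (λ _ → refl)

one-everywhere⇒PM : (G : Graph) (cubic : Cubic G) (χ : Edge G → Bool) →
  (∀ v → OneAt (star G cubic v) χ) → PerfectMatching G (tabulate χ)
one-everywhere⇒PM G cubic χ one v = one⇒matched G st (tabulate χ)
  (one-subst (sym (lookup∘tabulate χ _)) (sym (lookup∘tabulate χ _)) (sym (lookup∘tabulate χ _)) (one v))
  where st = star G cubic v

star-covers : {G : Graph} {v : Vertex G} (st : Star G v) (P : Edge G → Set) →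
  P (Star.a st) × P (Star.b st) × P (Star.c st) → ∀ e → Incident G e v → P e
star-covers st P (pa , pb , pc) e e-inc with Star.complete st e e-inc
... | inj₁ refl        = pa
... | inj₂ (inj₁ refl) = pb
... | inj₂ (inj₂ refl) = pc

multiplicity-at-star : (G : Graph) {v : Vertex G} (st : Star G v) {k : ℕ} (Ms : Fin k → EdgeSet G) →
  (∀ i → PerfectMatching G (Ms i)) →
  multiplicity G Ms (Star.a st) + multiplicity G Ms (Star.b st) + multiplicity G Ms (Star.c st) ≡ k
multiplicity-at-star G {v} st {k} Ms pm =
  countTrue-one k _ _ _ (λ i → matched⇒one G st (Ms i) (pm i v))

data Split211 : ℕ → ℕ → ℕ → Set where
  two-one-one : Split211 2 1 1
  one-two-one : Split211 1 2 1
  one-one-two : Split211 1 1 2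

-- Arithmetic normalisation used to remove the lower bounds 1 ≤ x, y, z.
sum-of-sucs : ∀ a b c → suc a + suc b + suc c ≡ 3 + (a + b + c)
sum-of-sucs a b c rewrite +-suc a b | +-suc (a + b) c = refl

split211 : ∀ x y z → 1 ≤ x → 1 ≤ y → 1 ≤ z → x + y + z ≡ 4 → Split211 x y z
split211 (suc a) (suc b) (suc c) _ _ _ eq =
  split (suc-injective (suc-injective (suc-injective (trans (sym (sum-of-sucs a b c)) eq))))
  where
    split : ∀ {a b c} → a + b + c ≡ 1 → Split211 (suc a) (suc b) (suc c)
    split {1} {0} {0} refl = two-one-one
    split {0} {1} {0} refl = one-two-one
    split {0} {0} {1} refl = one-one-two
    split {0} {0} {suc (suc _)} ()
    split {0} {suc (suc _)} ()
    split {0} {1} {suc _} ()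
    split {1} {suc _} ()
    split {1} {0} {suc _} ()
    split {suc (suc _)} ()

OneOrTwo : ℕ → Set
OneOrTwo n = (n ≡ 1) ⊎ (n ≡ 2)

isTwo : ℕ → Bool
isTwo n = does (n ≟ℕ 2)

split211-oneOrTwo : ∀ {x y z} → Split211 x y z → OneOrTwo x × OneOrTwo y × OneOrTwo z
split211-oneOrTwo two-one-one = inj₂ refl , inj₁ refl , inj₁ refl
split211-oneOrTwo one-two-one = inj₁ refl , inj₂ refl , inj₁ refl
split211-oneOrTwo one-one-two = inj₁ refl , inj₁ refl , inj₂ refl

split211-isTwo : ∀ {x y z} → Split211 x y z → One (isTwo x) (isTwo y) (isTwo z)
split211-isTwo two-one-one = first
split211-isTwo one-two-one = second
split211-isTwo one-one-two = third

outside : (G : Graph) → EdgeSet G → EdgeSet G → EdgeSet G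
outside G M N = tabulate λ e → not (lookup M e ∨ lookup N e)

-- If M and N are disjoint perfect matchings of a cubic graph, the remaining
-- edges form a perfect matching too: at each star M and N take two different
-- edges, leaving exactly the third.
outside-PM : (G : Graph) → Cubic G → (M N : EdgeSet G) →
  PerfectMatching G M → PerfectMatching G N → (∀ e → e ∈ M → e ∈ N → ⊥) →
  PerfectMatching G (outside G M N)
outside-PM G cubic M N pmM pmN disjoint =
  one-everywhere⇒PM G cubic (λ e → not (lookup M e ∨ lookup N e)) λ v →
  let st = star G cubic v in
  one-complement (matched⇒one G st M (pmM v)) (matched⇒one G st N (pmN v))
    (both _) (both _) (both _)
  where
    both : ∀ e → lookup M e ≡ true → lookup N e ≡ true → ⊥
    both e Me Ne = disjoint e (lookup⇒[]= e M Me) (lookup⇒[]= e N Ne)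

outside-cover : (G : Graph) (M N : EdgeSet G) (e : Edge G) →
  (e ∈ M) ⊎ (e ∈ N) ⊎ (e ∈ outside G M N)
outside-cover G M N e with lookup M e in Me
... | true = inj₁ (lookup⇒[]= e M Me)
... | false with lookup N e in Ne
...   | true  = inj₂ (inj₁ (lookup⇒[]= e N Ne))
...   | false = inj₂ (inj₂ (lookup⇒[]= e (outside G M N)
                  (trans (lookup∘tabulate (λ e → not (lookup M e ∨ lookup N e)) e)
                         (cong₂ (λ s t → not (s ∨ t)) Me Ne))))

disjoint⇒cover₃ : (G : Graph) → Cubic G → (M N : EdgeSet G) →
  PerfectMatching G M → PerfectMatching G N → (∀ e → e ∈ M → e ∈ N → ⊥) →
  HasPMCover G 3
disjoint⇒cover₃ G cubic M N pmM pmN disjoint = Ms , pm , cover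
  where
    Ms : Fin 3 → EdgeSet G
    Ms zero             = M
    Ms (suc zero)       = N
    Ms (suc (suc zero)) = outside G M N
    pm : ∀ i → PerfectMatching G (Ms i)
    pm zero             = pmM
    pm (suc zero)       = pmN
    pm (suc (suc zero)) = outside-PM G cubic M N pmM pmN disjoint
    cover : ∀ e → ∃ λ i → e ∈ Ms i
    cover e with outside-cover G M N e
    ... | inj₁ e∈M        = zero , e∈M
    ... | inj₂ (inj₁ e∈N) = suc zero , e∈N
    ... | inj₂ (inj₂ e∈O) = suc (suc zero) , e∈O

module CoverByFour (G : Graph) (cubic : Cubic G) (Ms : Fin 4 → EdgeSet G) (cover : IsPMCover G 4 Ms) where

  mult : Edge G → ℕ
  mult = multiplicity G Ms

  mult-pos : ∀ e → 1 ≤ mult e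
  mult-pos e = countTrue-pos 4 (λ i → lookup (Ms i) e) (proj₁ (proj₂ cover e)) ([]=⇒lookup (proj₂ (proj₂ cover e)))

  split-at : ∀ v (st : Star G v) → Split211 (mult (Star.a st)) (mult (Star.b st)) (mult (Star.c st))
  split-at v st = split211 _ _ _ (mult-pos _) (mult-pos _) (mult-pos _)
    (multiplicity-at-star G st Ms (proj₁ cover))

  -- Part (1): look at e inside the star of one of its ends.
  oneOrTwo : ∀ e → OneOrTwo (mult e)
  oneOrTwo e = star-covers st (λ e → OneOrTwo (mult e)) (split211-oneOrTwo (split-at _ st)) e (inj₁ refl)
    where st = star G cubic (end₁ G e)

  exactlyTwo-PM : PerfectMatching G (exactlyTwo G Ms)
  exactlyTwo-PM = one-everywhere⇒PM G cubic (λ e → isTwo (mult e)) λ v → split211-isTwo (split-at v (star G cubic v))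

  -- Disjoint Mᵢ, Mⱼ would give a cover by three perfect matchings.
  meet : PMIndexIs G 4 → ∀ i j → i ≢ j → ∃ λ e → (e ∈ Ms i) × (e ∈ Ms j)
  meet τ≡4 i j _ with any? (λ e → (e ∈? Ms i) ×-dec (e ∈? Ms j))
  ... | yes common = common
  ... | no  none   = ⊥-elim (proj₂ τ≡4 3 ≤-refl
          (disjoint⇒cover₃ G cubic (Ms i) (Ms j) (proj₁ cover i) (proj₁ cover j)
            λ e e∈Mᵢ e∈Mⱼ → none (e , e∈Mᵢ , e∈Mⱼ)))

proposition3p1 : (G : Graph) → Cubic G → (Ms : Fin 4 → EdgeSet G) → IsPMCover G 4 Ms →
    (∀ e → (multiplicity G Ms e ≡ 1) ⊎ (multiplicity G Ms e ≡ 2))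
    × PerfectMatching G (exactlyTwo G Ms)
    × (PMIndexIs G 4 → ∀ i j → i ≢ j → ∃ λ e → (e ∈ Ms i) × (e ∈ Ms j))
proposition3p1 G cubic Ms cover = oneOrTwo , exactlyTwo-PM , meet
  where open CoverByFour G cubic Ms cover
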